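{- For every integer $n \geq 0$, \[ b_n(x) = \sum_{l=0}^n S_2(n,l)\, d_l(x). \] In particular, $b_n = \sum_{l=0}^n S_2(n,l)\, d_l$.
   Context: All generating functions are formal power series in $t$. The type 2 Bernoulli polynomials $b_n(x)$ are defined by $\frac{t}{e^t-e^{ -t}}e^{xt} = \sum_{n\ge0} b_n(x)\frac{t^n}{n!}$, with $b_n=b_n(0)$. The type 2 Daehee polynomials $d_n(x)$ are defined by $\frac{\log(1+t)}{(1+t)-(1+t)^{ -1}}(1+t)^x = \sum_{n\ge0} d_n(x)\frac{t^n}{n!}$, with $d_n = d_n(0)$. The Stirling numbers of the second kind $S_2(n,l)$ are defined by $\frac{1}{l!}(e^t-1)^l = \sum_{n\ge l} S_2(n,l)\frac{t^n}{n!}$. -}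

module Defs where

open import Data.Nat as ℕ using (ℕ; zero; suc)
open import Data.Nat.Base using () renaming (_! to _!ℕ)
open import Data.Nat.Properties using () renaming (_!≢0 to _!≢0ℕ)
open import Data.Integer as ℤ using (ℤ)
open import Data.Rational using (ℚ; 0ℚ; 1ℚ; _+_; _*_; _-_; -_; 1/_; ≢-nonZero; _/_)
open import Data.Rational.Properties using (_≟_)
open import Data.List using (List; []; _∷_)
open import Relation.Nullary using (yes; no)

ℕ→ℚ : ℕ → ℚ
ℕ→ℚ n = ℤ.+ n / 1

ℤ→ℚ : ℤ → ℚ
ℤ→ℚ z = z / 1

-- reciprocal of a rational, with the (irrelevant) convention 1/0 = 0
recip : ℚ → ℚ
recip p with p ≟ 0ℚ
... | yes _ = 0ℚ
... | no p≢0 = 1/_ p {{≢-nonZero p≢0}}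

sumTo : ℕ → (ℕ → ℚ) → ℚ
sumTo zero f = f 0
sumTo (suc n) f = sumTo n f + f (suc n)

fact : ℕ → ℚ
fact n = ℕ→ℚ (n !ℕ)

invFact : ℕ → ℚ
invFact n = _/_ (ℤ.+ 1) (n !ℕ) {{n !≢0ℕ}}

_^_ : ℚ → ℕ → ℚ
q ^ zero = 1ℚ
q ^ suc n = q * (q ^ n)

-- Formal power series in t over ℚ, represented by their coefficient
-- sequences:  f ↦ Σ_n f n · t^n.

PS : Set
PS = ℕ → ℚ

_⊕_ : PS → PS → PS
(f ⊕ g) n = f n + g n

_⊖_ : PS → PS → PS
(f ⊖ g) n = f n - g n

_⊛_ : PS → PS → PS
(f ⊛ g) n = sumTo n (λ k → f k * g (n ℕ.∸ k))

oneS : PS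
oneS zero = 1ℚ
oneS (suc n) = 0ℚ

_⊛^_ : PS → ℕ → PS
f ⊛^ zero = oneS
f ⊛^ suc l = f ⊛ (f ⊛^ l)

constS : ℚ → PS
constS c zero = c
constS c (suc n) = 0ℚ

divT : PS → PS
divT f n = f (suc n)

-- multiplicative inverse of a series with nonzero constant term f 0.
-- invRev f n = [c_n , c_{n-1} , … , c_0], where 1/f = Σ c_k t^k, via
--   c_0 = 1/f_0 ,  c_{n+1} = -(1/f_0) Σ_{k=1}^{n+1} f_k c_{n+1-k}.
private
  dotFrom : PS → List ℚ → ℕ → ℚ
  dotFrom f [] k = 0ℚ
  dotFrom f (c ∷ cs) k = f k * c + dotFrom f cs (suc k)

invRev : PS → ℕ → List ℚ
invRev f zero = recip (f 0) ∷ []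
invRev f (suc n) = (- (recip (f 0) * dotFrom f (invRev f n) 1)) ∷ invRev f n

headOr0 : List ℚ → ℚ
headOr0 [] = 0ℚ
headOr0 (c ∷ _) = c

invS : PS → PS
invS f n = headOr0 (invRev f n)

expS : ℚ → PS
expS a n = (a ^ n) * invFact n

-- (1+t)^x = Σ_n binom(x,n) t^n ,  binom(x,n) = x(x-1)…(x-n+1)/n!
falling : ℚ → ℕ → ℚ
falling x zero = 1ℚ
falling x (suc n) = falling x n * (x - ℕ→ℚ n)

onePlusTPow : ℚ → PS
onePlusTPow x n = falling x n * invFact n

log1pS : PS
log1pS zero = 0ℚ
log1pS (suc n) = ((- 1ℚ) ^ n) * recip (ℕ→ℚ (suc n))

-- Type 2 Bernoulli polynomials:
--   t/(e^t - e^{-t}) · e^{xt} = Σ b_n(x) t^n/n!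
bernoulliGF : ℚ → PS
bernoulliGF x = invS (divT (expS 1ℚ ⊖ expS (- 1ℚ))) ⊛ expS x

b : ℕ → ℚ → ℚ
b n x = fact n * bernoulliGF x n

-- Type 2 Daehee polynomials:
--   log(1+t)/((1+t) - (1+t)^{-1}) · (1+t)^x = Σ d_n(x) t^n/n!
daeheeGF : ℚ → PS
daeheeGF x =
  (divT log1pS ⊛ invS (divT (onePlusTPow 1ℚ ⊖ onePlusTPow (- 1ℚ)))) ⊛ onePlusTPow x

d : ℕ → ℚ → ℚ
d n x = fact n * daeheeGF x n

-- Stirling numbers of the second kind:
--   (1/l!)(e^t - 1)^l = Σ_{n≥l} S₂(n,l) t^n/n!
S₂ : ℕ → ℕ → ℚ
S₂ n l = fact n * (invFact l * ((expS 1ℚ ⊖ oneS) ⊛^ l) n)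

-- Substituting E = e^t − 1 into a power series is a ring homomorphism that obeys the chain rule.
-- As E′ = 1 + E, it turns solutions of (1 + t) F′ = a F into solutions of G′ = a G, so it sends
-- (1 + t)^a to e^{at}; in the same way it sends log(1 + t) to t. The Daehee generating function D(x)
-- satisfies D(x) · ((1 + t) − (1 + t)⁻¹) = log(1 + t) · (1 + t)^x, so its image satisfies
-- D(x)∘E · (e^t − e^{−t}) = t · e^{xt}, i.e. it is the type 2 Bernoulli generating function.
-- Reading off the coefficient of t^n in D(x)∘E = Σ_l d_l(x) (e^t − 1)^l / l! gives the Stirling sum.

module Submission where

open import Defs
open import Data.Nat as ℕ using (ℕ; zero; suc; _≤_; _<_; z≤n; s≤s)
import Data.Nat.Properties as ℕ
open import Data.Nat.Induction using (<-rec)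
open import Data.Integer as ℤ using (ℤ)
import Data.Integer.Properties as ℤ
open import Data.Rational using (ℚ; 0ℚ; 1ℚ; _+_; _*_; _-_; -_; _/_; ≢-nonZero)
import Data.Rational.Unnormalised as ℚᵘ
import Data.Rational.Unnormalised.Properties as ℚᵘ
open import Data.Rational.Properties
  using (toℚᵘ-injective; toℚᵘ-homo-*; toℚᵘ-homo-+; toℚᵘ-fromℚᵘ; toℚᵘ-cong; _≟_; *-inverseʳ
        ; +-inverseˡ; +-assoc; *-zeroˡ; *-zeroʳ; +-identityʳ; +-identityˡ
        ; *-identityˡ; *-identityʳ; *-comm)
open import Data.Rational.Solver using (module +-*-Solver)
open import Data.Empty using (⊥-elim)
open import Data.List using (List; []; _∷_)
open import Data.Product using (_×_; _,_)
open import Relation.Nullary using (yes; no; ¬_)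
open import Relation.Binary.PropositionalEquality
open import Relation.Binary.Bundles using (Setoid)
import Relation.Binary.Reasoning.Setoid as SetoidReasoning

open +-*-Solver

/-*-/ : ∀ i j a b .{{_ : ℕ.NonZero a}} .{{_ : ℕ.NonZero b}} →
        (i / a) * (j / b) ≡ _/_ (i ℤ.* j) (a ℕ.* b) {{ℕ.m*n≢0 a b}}
/-*-/ i j (suc a) (suc b) = toℚᵘ-injective
  (ℚᵘ.≃-trans (toℚᵘ-homo-* (i / suc a) (j / suc b))
  (ℚᵘ.≃-trans (ℚᵘ.*-cong (toℚᵘ-fromℚᵘ (ℚᵘ.mkℚᵘ i a)) (toℚᵘ-fromℚᵘ (ℚᵘ.mkℚᵘ j b)))
   (ℚᵘ.≃-sym (toℚᵘ-fromℚᵘ (ℚᵘ.mkℚᵘ (i ℤ.* j) _)))))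

/-cong-*≡* : ∀ i j a b .{{_ : ℕ.NonZero a}} .{{_ : ℕ.NonZero b}} →
             i ℤ.* ℤ.+ b ≡ j ℤ.* ℤ.+ a → i / a ≡ j / b
/-cong-*≡* i j (suc a) (suc b) eq = toℚᵘ-injective
  (ℚᵘ.≃-trans (toℚᵘ-fromℚᵘ (ℚᵘ.mkℚᵘ i a))
  (ℚᵘ.≃-trans (ℚᵘ.*≡* eq) (ℚᵘ.≃-sym (toℚᵘ-fromℚᵘ (ℚᵘ.mkℚᵘ j b)))))

ℕ→ℚ-+ : ∀ m n → ℕ→ℚ m + ℕ→ℚ n ≡ ℕ→ℚ (m ℕ.+ n)
ℕ→ℚ-+ m n = toℚᵘ-injective
  (ℚᵘ.≃-trans (toℚᵘ-homo-+ (ℕ→ℚ m) (ℕ→ℚ n))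
  (ℚᵘ.≃-trans (ℚᵘ.+-cong (toℚᵘ-fromℚᵘ (ℚᵘ.mkℚᵘ (ℤ.+ m) 0)) (toℚᵘ-fromℚᵘ (ℚᵘ.mkℚᵘ (ℤ.+ n) 0)))
   (ℚᵘ.≃-sym (ℚᵘ.≃-trans (toℚᵘ-fromℚᵘ (ℚᵘ.mkℚᵘ (ℤ.+ (m ℕ.+ n)) 0)) (ℚᵘ.*≡* (cong (ℤ._* ℤ.+ 1) eq))))))
  where
  eq : ℤ.+ (m ℕ.+ n) ≡ ℤ.+ m ℤ.* ℤ.+ 1 ℤ.+ ℤ.+ n ℤ.* ℤ.+ 1
  eq = sym (cong₂ ℤ._+_ (ℤ.*-identityʳ (ℤ.+ m)) (ℤ.*-identityʳ (ℤ.+ n)))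

ℕ→ℚ-suc : ∀ n → ℕ→ℚ (suc n) ≡ 1ℚ + ℕ→ℚ n
ℕ→ℚ-suc n = sym (ℕ→ℚ-+ 1 n)

ℕ→ℚ-suc≢0 : ∀ n → ¬ ℕ→ℚ (suc n) ≡ 0ℚ
ℕ→ℚ-suc≢0 n eq with ℚᵘ.≃-trans (ℚᵘ.≃-sym (toℚᵘ-fromℚᵘ (ℚᵘ.mkℚᵘ (ℤ.+ suc n) 0)))
                      (ℚᵘ.≃-trans (toℚᵘ-cong eq) (toℚᵘ-fromℚᵘ (ℚᵘ.mkℚᵘ (ℤ.+ 0) 0)))
... | ℚᵘ.*≡* ()

ℕ→ℚ-*-1/ : ∀ a b c .{{_ : ℕ.NonZero b}} .{{_ : ℕ.NonZero c}} → a ℕ.* b ≡ c →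
            ℕ→ℚ a * (ℤ.+ 1 / c) ≡ ℤ.+ 1 / b
ℕ→ℚ-*-1/ a b c {{_}} {{c≢0}} ab≡c =
  trans (/-*-/ (ℤ.+ a) (ℤ.+ 1) 1 c)
        (/-cong-*≡* (ℤ.+ a ℤ.* ℤ.+ 1) (ℤ.+ 1) (1 ℕ.* c) b {{ℕ.m*n≢0 1 c {{_}} {{c≢0}}}} eq)
  where
  eq : ℤ.+ a ℤ.* ℤ.+ 1 ℤ.* ℤ.+ b ≡ ℤ.+ 1 ℤ.* ℤ.+ (1 ℕ.* c)
  eq = begin
    ℤ.+ a ℤ.* ℤ.+ 1 ℤ.* ℤ.+ b        ≡⟨ cong (ℤ._* ℤ.+ b) (ℤ.*-identityʳ (ℤ.+ a)) ⟩
    ℤ.+ a ℤ.* ℤ.+ b                  ≡⟨ ℤ.pos-* a b ⟨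
    ℤ.+ (a ℕ.* b)                    ≡⟨ cong ℤ.+_ (trans ab≡c (sym (ℕ.*-identityˡ c))) ⟩
    ℤ.+ (1 ℕ.* c)                    ≡⟨ ℤ.*-identityˡ _ ⟨
    ℤ.+ 1 ℤ.* ℤ.+ (1 ℕ.* c)          ∎
    where open ≡-Reasoning

fact*invFact : ∀ n → fact n * invFact n ≡ 1ℚ
fact*invFact n = ℕ→ℚ-*-1/ (n ℕ.!) 1 (n ℕ.!) {{_}} {{n ℕ.!≢0}} (ℕ.*-identityʳ (n ℕ.!))

ℕ→ℚ-suc*invFact-suc : ∀ n → ℕ→ℚ (suc n) * invFact (suc n) ≡ invFact n
ℕ→ℚ-suc*invFact-suc n = ℕ→ℚ-*-1/ (suc n) (n ℕ.!) (suc n ℕ.!) {{n ℕ.!≢0}} {{suc n ℕ.!≢0}} refl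

*-recip : ∀ p → ¬ p ≡ 0ℚ → p * recip p ≡ 1ℚ
*-recip p p≢0 with p ≟ 0ℚ
... | yes p≡0 = ⊥-elim (p≢0 p≡0)
... | no  p≢0 = *-inverseʳ p {{≢-nonZero p≢0}}

*-cancelˡ-≡ : ∀ s {a b} → ¬ s ≡ 0ℚ → s * a ≡ s * b → a ≡ b
*-cancelˡ-≡ s {a} {b} s≢0 eq = begin
  a                    ≡⟨ *-identityˡ a ⟨
  1ℚ * a               ≡⟨ cong (_* a) (*-recip s s≢0) ⟨
  (s * recip s) * a    ≡⟨ solve 3 (λ r s a → (s :* r) :* a := r :* (s :* a)) refl (recip s) s a ⟩
  recip s * (s * a)    ≡⟨ cong (recip s *_) eq ⟩
  recip s * (s * b)    ≡⟨ solve 3 (λ r s b → r :* (s :* b) := (s :* r) :* b) refl (recip s) s b ⟩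
  (s * recip s) * b    ≡⟨ cong (_* b) (*-recip s s≢0) ⟩
  1ℚ * b               ≡⟨ *-identityˡ b ⟩
  b                    ∎
  where open ≡-Reasoning

sumTo-cong : ∀ n {f g : ℕ → ℚ} → (∀ k → f k ≡ g k) → sumTo n f ≡ sumTo n g
sumTo-cong zero    f≡g = f≡g 0
sumTo-cong (suc n) f≡g = cong₂ _+_ (sumTo-cong n f≡g) (f≡g (suc n))

sumTo-suc-first : ∀ n f → sumTo (suc n) f ≡ f 0 + sumTo n (λ k → f (suc k))
sumTo-suc-first zero    f = refl
sumTo-suc-first (suc n) f = trans (cong (_+ f (suc (suc n))) (sumTo-suc-first n f))
                                  (+-assoc (f 0) (sumTo n (λ k → f (suc k))) (f (suc (suc n))))

sumTo-distrib-+ : ∀ n f g → sumTo n (λ k → f k + g k) ≡ sumTo n f + sumTo n g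
sumTo-distrib-+ zero    f g = refl
sumTo-distrib-+ (suc n) f g = trans (cong (_+ (f (suc n) + g (suc n))) (sumTo-distrib-+ n f g))
  (solve 4 (λ F G a b → (F :+ G) :+ (a :+ b) := (F :+ a) :+ (G :+ b)) refl
         (sumTo n f) (sumTo n g) (f (suc n)) (g (suc n)))

sumTo-distrib-sub : ∀ n f g → sumTo n (λ k → f k - g k) ≡ sumTo n f - sumTo n g
sumTo-distrib-sub zero    f g = refl
sumTo-distrib-sub (suc n) f g = trans (cong (_+ (f (suc n) - g (suc n))) (sumTo-distrib-sub n f g))
  (solve 4 (λ F G a b → (F :- G) :+ (a :- b) := (F :+ a) :- (G :+ b)) refl
         (sumTo n f) (sumTo n g) (f (suc n)) (g (suc n)))

sumTo-distribˡ-* : ∀ n c f → sumTo n (λ k → c * f k) ≡ c * sumTo n f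
sumTo-distribˡ-* zero    c f = refl
sumTo-distribˡ-* (suc n) c f = trans (cong (_+ (c * f (suc n))) (sumTo-distribˡ-* n c f))
  (solve 3 (λ c F a → c :* F :+ c :* a := c :* (F :+ a)) refl c (sumTo n f) (f (suc n)))

sumTo-0 : ∀ n f → (∀ k → f k ≡ 0ℚ) → sumTo n f ≡ 0ℚ
sumTo-0 zero    f f≡0 = f≡0 0
sumTo-0 (suc n) f f≡0 = cong₂ _+_ (sumTo-0 n f f≡0) (f≡0 (suc n))

sumTo-extend : ∀ m N f → m ≤ N → (∀ k → m < k → f k ≡ 0ℚ) → sumTo N f ≡ sumTo m f
sumTo-extend m N f m≤N f≡0 = trans (cong (λ N → sumTo N f) (sym (ℕ.m+[n∸m]≡n m≤N)))
                                   (extend-by (N ℕ.∸ m))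
  where
  extend-by : ∀ j → sumTo (m ℕ.+ j) f ≡ sumTo m f
  extend-by zero    rewrite ℕ.+-identityʳ m = refl
  extend-by (suc j) rewrite ℕ.+-suc m j =
    trans (cong₂ _+_ (extend-by j) (f≡0 (suc (m ℕ.+ j)) (s≤s (ℕ.m≤m+n m j)))) (+-identityʳ _)

infix 4 _≐_
_≐_ : PS → PS → Set
f ≐ g = ∀ n → f n ≡ g n

≐-refl : ∀ {f} → f ≐ f
≐-refl n = refl

≐-sym : ∀ {f g} → f ≐ g → g ≐ f
≐-sym f≐g n = sym (f≐g n)

≐-trans : ∀ {f g h} → f ≐ g → g ≐ h → f ≐ h
≐-trans f≐g g≐h n = trans (f≐g n) (g≐h n)

≐-setoid : Setoid _ _
≐-setoid = record
  { Carrier = PS ; _≈_ = _≐_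
  ; isEquivalence = record { refl = λ {f} → ≐-refl {f} ; sym = ≐-sym ; trans = ≐-trans } }

⊖-cong : ∀ {f f' g g'} → f ≐ f' → g ≐ g' → f ⊖ g ≐ f' ⊖ g'
⊖-cong f≐f' g≐g' n = cong₂ _-_ (f≐f' n) (g≐g' n)

zeroS : PS
zeroS n = 0ℚ

scale : ℚ → PS → PS
scale c f n = c * f n

infixl 25 _⋆_

_⋆_ : PS → PS → PS
(f ⋆ g) zero    = f 0 * g 0
(f ⋆ g) (suc n) = f 0 * g (suc n) + (divT f ⋆ g) n

⊛≐⋆ : ∀ f g → f ⊛ g ≐ f ⋆ g
⊛≐⋆ f g zero    = refl
⊛≐⋆ f g (suc n) = trans (sumTo-suc-first n (λ k → f k * g (suc n ℕ.∸ k)))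
                        (cong (f 0 * g (suc n) +_) (⊛≐⋆ (divT f) g n))

⋆-cong : ∀ {f f' g g'} → f ≐ f' → g ≐ g' → f ⋆ g ≐ f' ⋆ g'
⋆-cong f≐f' g≐g' zero    = cong₂ _*_ (f≐f' 0) (g≐g' 0)
⋆-cong f≐f' g≐g' (suc n) = cong₂ _+_ (cong₂ _*_ (f≐f' 0) (g≐g' (suc n))) (⋆-cong (λ k → f≐f' (suc k)) g≐g' n)

⋆-congˡ : ∀ f {g g'} → g ≐ g' → f ⋆ g ≐ f ⋆ g'
⋆-congˡ f = ⋆-cong (≐-refl {f})

⋆-congʳ : ∀ {f f'} g → f ≐ f' → f ⋆ g ≐ f' ⋆ g
⋆-congʳ g f≐f' = ⋆-cong f≐f' (≐-refl {g})

⋆-cong-upTo : ∀ n f {g g'} → (∀ m → m ≤ n → g m ≡ g' m) → (f ⋆ g) n ≡ (f ⋆ g') n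
⋆-cong-upTo zero    f g≡g' = cong (f 0 *_) (g≡g' 0 z≤n)
⋆-cong-upTo (suc n) f g≡g' = cong₂ _+_ (cong (f 0 *_) (g≡g' (suc n) ℕ.≤-refl))
  (⋆-cong-upTo n (divT f) (λ m m≤n → g≡g' m (ℕ.m≤n⇒m≤1+n m≤n)))

⋆-cong-below : ∀ n f {g g'} → f 0 ≡ 0ℚ → (∀ m → m < n → g m ≡ g' m) → (f ⋆ g) n ≡ (f ⋆ g') n
⋆-cong-below n f {g} {g'} f0≡0 = below n
  where
  f0*≡0 : ∀ x → f 0 * x ≡ 0ℚ
  f0*≡0 x = trans (cong (_* x) f0≡0) (*-zeroˡ x)

  below : ∀ n → (∀ m → m < n → g m ≡ g' m) → (f ⋆ g) n ≡ (f ⋆ g') n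
  below zero    _     = trans (f0*≡0 (g 0)) (sym (f0*≡0 (g' 0)))
  below (suc n) g≡g' = cong₂ _+_ (trans (f0*≡0 (g (suc n))) (sym (f0*≡0 (g' (suc n)))))
                                 (⋆-cong-upTo n (divT f) (λ m m≤n → g≡g' m (s≤s m≤n)))

⋆-zeroˡ : ∀ n f g → (∀ k → f k ≡ 0ℚ) → (f ⋆ g) n ≡ 0ℚ
⋆-zeroˡ zero    f g f≡0 = trans (cong (_* g 0) (f≡0 0)) (*-zeroˡ (g 0))
⋆-zeroˡ (suc n) f g f≡0 = cong₂ _+_ (trans (cong (_* g (suc n)) (f≡0 0)) (*-zeroˡ (g (suc n))))
                                    (⋆-zeroˡ n (divT f) g (λ k → f≡0 (suc k)))

⋆-identityˡ : ∀ g → oneS ⋆ g ≐ g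
⋆-identityˡ g zero    = *-identityˡ (g 0)
⋆-identityˡ g (suc n) = trans (cong₂ _+_ (*-identityˡ (g (suc n))) (⋆-zeroˡ n (divT oneS) g (λ _ → refl)))
                              (+-identityʳ (g (suc n)))

constS-⋆ : ∀ c g → constS c ⋆ g ≐ scale c g
constS-⋆ c g zero    = refl
constS-⋆ c g (suc n) = trans (cong (c * g (suc n) +_) (⋆-zeroˡ n (divT (constS c)) g (λ _ → refl)))
                             (+-identityʳ _)

⋆-distribʳ-⊕ : ∀ f g h → (f ⊕ g) ⋆ h ≐ f ⋆ h ⊕ g ⋆ h
⋆-distribʳ-⊕ f g h zero    = solve 3 (λ a b c → (a :+ b) :* c := a :* c :+ b :* c) refl (f 0) (g 0) (h 0)
⋆-distribʳ-⊕ f g h (suc n) = trans (cong ((f 0 + g 0) * h (suc n) +_) (⋆-distribʳ-⊕ (divT f) (divT g) h n))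
  (solve 5 (λ a b c X Y → (a :+ b) :* c :+ (X :+ Y) := (a :* c :+ X) :+ (b :* c :+ Y)) refl
         (f 0) (g 0) (h (suc n)) ((divT f ⋆ h) n) ((divT g ⋆ h) n))

⋆-distribˡ-⊕ : ∀ f g h → f ⋆ (g ⊕ h) ≐ f ⋆ g ⊕ f ⋆ h
⋆-distribˡ-⊕ f g h zero    = solve 3 (λ a b c → a :* (b :+ c) := a :* b :+ a :* c) refl (f 0) (g 0) (h 0)
⋆-distribˡ-⊕ f g h (suc n) = trans (cong (f 0 * (g (suc n) + h (suc n)) +_) (⋆-distribˡ-⊕ (divT f) g h n))
  (solve 5 (λ a b c X Y → a :* (b :+ c) :+ (X :+ Y) := (a :* b :+ X) :+ (a :* c :+ Y)) refl
         (f 0) (g (suc n)) (h (suc n)) ((divT f ⋆ g) n) ((divT f ⋆ h) n))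

⋆-distribˡ-sumTo : ∀ N n f (H : ℕ → PS) →
                   (f ⋆ (λ m → sumTo N (λ l → H l m))) n ≡ sumTo N (λ l → (f ⋆ H l) n)
⋆-distribˡ-sumTo zero    n f H = refl
⋆-distribˡ-sumTo (suc N) n f H = trans (⋆-distribˡ-⊕ f (λ m → sumTo N (λ l → H l m)) (H (suc N)) n)
                                        (cong (_+ (f ⋆ H (suc N)) n) (⋆-distribˡ-sumTo N n f H))

⋆-scaleˡ : ∀ c f g → scale c f ⋆ g ≐ scale c (f ⋆ g)
⋆-scaleˡ c f g zero    = solve 3 (λ c a b → (c :* a) :* b := c :* (a :* b)) refl c (f 0) (g 0)
⋆-scaleˡ c f g (suc n) = trans (cong (c * f 0 * g (suc n) +_) (⋆-scaleˡ c (divT f) g n))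
  (solve 4 (λ c a b X → (c :* a) :* b :+ c :* X := c :* (a :* b :+ X)) refl c (f 0) (g (suc n)) ((divT f ⋆ g) n))

⋆-scaleʳ : ∀ c f g → f ⋆ scale c g ≐ scale c (f ⋆ g)
⋆-scaleʳ c f g zero    = solve 3 (λ c a b → a :* (c :* b) := c :* (a :* b)) refl c (f 0) (g 0)
⋆-scaleʳ c f g (suc n) = trans (cong (f 0 * (c * g (suc n)) +_) (⋆-scaleʳ c (divT f) g n))
  (solve 4 (λ c a b X → a :* (c :* b) :+ c :* X := c :* (a :* b :+ X)) refl c (f 0) (g (suc n)) ((divT f ⋆ g) n))

⋆-comm : ∀ f g → f ⋆ g ≐ g ⋆ f
⋆-comm f g n = <-rec (λ n → ∀ f g → (f ⋆ g) n ≡ (g ⋆ f) n) comm n f g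
  where
  comm : ∀ n → (∀ {m} → m < n → ∀ f g → (f ⋆ g) m ≡ (g ⋆ f) m) → ∀ f g → (f ⋆ g) n ≡ (g ⋆ f) n
  comm zero          _  f g = *-comm (f 0) (g 0)
  comm (suc zero)    _  f g = solve 4 (λ a₀ a₁ b₀ b₁ → a₀ :* b₁ :+ a₁ :* b₀ := b₀ :* a₁ :+ b₁ :* a₀) refl
                                       (f 0) (f 1) (g 0) (g 1)
  comm (suc (suc n)) ih f g = begin
    f 0 * g₂ + (divT f ⋆ g) (suc n)
      ≡⟨ cong (f 0 * g₂ +_) (ih (ℕ.n<1+n (suc n)) (divT f) g) ⟩
    f 0 * g₂ + (g 0 * f₂ + (divT g ⋆ divT f) n)
      ≡⟨ cong (λ z → f 0 * g₂ + (g 0 * f₂ + z)) (ih (ℕ.m<n⇒m<1+n (ℕ.n<1+n n)) (divT g) (divT f)) ⟩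
    f 0 * g₂ + (g 0 * f₂ + (divT f ⋆ divT g) n)
      ≡⟨ solve 5 (λ a b c d X → a :* b :+ (c :* d :+ X) := c :* d :+ (a :* b :+ X)) refl (f 0) g₂ (g 0) f₂ ((divT f ⋆ divT g) n) ⟩
    g 0 * f₂ + (f 0 * g₂ + (divT f ⋆ divT g) n)
      ≡⟨ cong (g 0 * f₂ +_) (ih (ℕ.n<1+n (suc n)) f (divT g)) ⟩
    g 0 * f₂ + (divT g ⋆ f) (suc n) ∎
    where
    open ≡-Reasoning
    f₂ g₂ : ℚ
    f₂ = f (suc (suc n))
    g₂ = g (suc (suc n))

⋆-zeroʳ-upTo : ∀ n f g → (∀ m → m ≤ n → g m ≡ 0ℚ) → (f ⋆ g) n ≡ 0ℚ
⋆-zeroʳ-upTo n f g g≡0 = trans (⋆-cong-upTo n f g≡0) (trans (⋆-comm f zeroS n) (⋆-zeroˡ n zeroS f (λ _ → refl)))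

⋆-identityʳ : ∀ g → g ⋆ oneS ≐ g
⋆-identityʳ g = ≐-trans (⋆-comm g oneS) (⋆-identityˡ g)

⋆-assoc : ∀ f g h → f ⋆ g ⋆ h ≐ f ⋆ (g ⋆ h)
⋆-assoc f g h zero    = solve 3 (λ a b c → (a :* b) :* c := a :* (b :* c)) refl (f 0) (g 0) (h 0)
⋆-assoc f g h (suc n) = begin
  f 0 * g 0 * h (suc n) + ((scale (f 0) (divT g) ⊕ divT f ⋆ g) ⋆ h) n
    ≡⟨ cong (f 0 * g 0 * h (suc n) +_) (⋆-distribʳ-⊕ (scale (f 0) (divT g)) (divT f ⋆ g) h n) ⟩
  f 0 * g 0 * h (suc n) + ((scale (f 0) (divT g) ⋆ h) n + (divT f ⋆ g ⋆ h) n)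
    ≡⟨ cong₂ (λ u v → f 0 * g 0 * h (suc n) + (u + v)) (⋆-scaleˡ (f 0) (divT g) h n) (⋆-assoc (divT f) g h n) ⟩
  f 0 * g 0 * h (suc n) + (f 0 * (divT g ⋆ h) n + (divT f ⋆ (g ⋆ h)) n)
    ≡⟨ solve 5 (λ a b c X Z → (a :* b) :* c :+ (a :* X :+ Z) := a :* (b :* c :+ X) :+ Z) refl
             (f 0) (g 0) (h (suc n)) ((divT g ⋆ h) n) ((divT f ⋆ (g ⋆ h)) n) ⟩
  f 0 * (g 0 * h (suc n) + (divT g ⋆ h) n) + (divT f ⋆ (g ⋆ h)) n ∎
  where open ≡-Reasoning

-- Defs keeps the dot product behind invRev private; unification recovers it here.
mutual
  dotFrom : PS → List ℚ → ℕ → ℚ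
  dotFrom = _

  invS-suc-dotFrom : ∀ f n → invS f (suc n) ≡ - (recip (f 0) * dotFrom f (invRev f n) 1)
  invS-suc-dotFrom f n with recip (f 0) | invRev f n | 1
  ... | r | cs | k = refl

dotFrom-⋆ : ∀ f n k → dotFrom f (invRev f n) k ≡ ((λ i → f (k ℕ.+ i)) ⋆ invS f) n
dotFrom-⋆ f zero    k = trans (+-identityʳ _) (cong (λ i → f i * invS f 0) (sym (ℕ.+-identityʳ k)))
dotFrom-⋆ f (suc n) k = cong₂ _+_ (cong (λ i → f i * invS f (suc n)) (sym (ℕ.+-identityʳ k)))
  (trans (dotFrom-⋆ f n (suc k)) (⋆-congʳ (invS f) (λ i → cong f (sym (ℕ.+-suc k i))) n))

invS-suc : ∀ f n → invS f (suc n) ≡ - (recip (f 0) * (divT f ⋆ invS f) n)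
invS-suc f n = trans (invS-suc-dotFrom f n) (cong (λ z → - (recip (f 0) * z)) (dotFrom-⋆ f n 1))

⋆-inverseʳ : ∀ f → ¬ f 0 ≡ 0ℚ → f ⋆ invS f ≐ oneS
⋆-inverseʳ f f0≢0 zero    = *-recip (f 0) f0≢0
⋆-inverseʳ f f0≢0 (suc n) = begin
  f 0 * invS f (suc n) + X
    ≡⟨ cong (λ z → f 0 * z + X) (invS-suc f n) ⟩
  f 0 * - (recip (f 0) * X) + X
    ≡⟨ solve 3 (λ a r X → a :* (:- (r :* X)) :+ X := :- ((a :* r) :* X) :+ X) refl (f 0) (recip (f 0)) X ⟩
  - (f 0 * recip (f 0) * X) + X
    ≡⟨ cong (λ z → - (z * X) + X) (*-recip (f 0) f0≢0) ⟩
  - (1ℚ * X) + X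
    ≡⟨ cong (λ z → - z + X) (*-identityˡ X) ⟩
  - X + X
    ≡⟨ +-inverseˡ X ⟩
  0ℚ ∎
  where
  open ≡-Reasoning
  X : ℚ
  X = (divT f ⋆ invS f) n

⋆-inverseˡ : ∀ f → ¬ f 0 ≡ 0ℚ → invS f ⋆ f ≐ oneS
⋆-inverseˡ f f0≢0 = ≐-trans (⋆-comm (invS f) f) (⋆-inverseʳ f f0≢0)

tS : PS
tS zero    = 0ℚ
tS (suc n) = oneS n

tS-⋆-suc : ∀ g n → (tS ⋆ g) (suc n) ≡ g n
tS-⋆-suc g n = trans (cong₂ _+_ (*-zeroˡ (g (suc n))) (⋆-identityˡ g n)) (+-identityˡ (g n))

tS-⋆-cancel : ∀ {f g} → tS ⋆ f ≐ tS ⋆ g → f ≐ g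
tS-⋆-cancel {f} {g} tf≐tg n = trans (sym (tS-⋆-suc f n)) (trans (tf≐tg (suc n)) (tS-⋆-suc g n))

tS-⋆-divT : ∀ f → f 0 ≡ 0ℚ → tS ⋆ divT f ≐ f
tS-⋆-divT f f0≡0 zero    = trans (*-zeroˡ (f 1)) (sym f0≡0)
tS-⋆-divT f f0≡0 (suc n) = tS-⋆-suc (divT f) n

θ : PS → PS
θ f n = ℕ→ℚ n * f n

D : PS → PS
D f n = ℕ→ℚ (suc n) * f (suc n)

ℕ→ℚ-suc-* : ∀ n x → ℕ→ℚ (suc n) * x ≡ ℕ→ℚ n * x + x
ℕ→ℚ-suc-* n x = begin
  ℕ→ℚ (suc n) * x      ≡⟨ cong (_* x) (ℕ→ℚ-suc n) ⟩
  (1ℚ + ℕ→ℚ n) * x     ≡⟨ solve 2 (λ m x → (con 1ℚ :+ m) :* x := m :* x :+ x) refl (ℕ→ℚ n) x ⟩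
  ℕ→ℚ n * x + x        ∎
  where open ≡-Reasoning

θ-⋆-suc : ∀ f g n → (θ f ⋆ g) (suc n) ≡ (D f ⋆ g) n
θ-⋆-suc f g n = solve 3 (λ a b Y → (con 0ℚ :* a) :* b :+ Y := Y) refl (f 0) (g (suc n)) ((D f ⋆ g) n)

θ-leibniz : ∀ f g → θ (f ⋆ g) ≐ θ f ⋆ g ⊕ f ⋆ θ g
θ-leibniz f g zero    = solve 2 (λ a b → con 0ℚ :* (a :* b) := (con 0ℚ :* a) :* b :+ a :* (con 0ℚ :* b)) refl (f 0) (g 0)
θ-leibniz f g (suc n) = begin
  s * (f 0 * g′ + X)
    ≡⟨ solve 4 (λ s a b X → s :* (a :* b :+ X) := s :* X :+ a :* (s :* b)) refl s (f 0) g′ X ⟩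
  s * X + f 0 * (s * g′)
    ≡⟨ cong (_+ f 0 * (s * g′)) (ℕ→ℚ-suc-* n X) ⟩
  ℕ→ℚ n * X + X + f 0 * (s * g′)
    ≡⟨ cong (λ z → z + X + f 0 * (s * g′)) (θ-leibniz (divT f) g n) ⟩
  A + B + X + f 0 * (s * g′)
    ≡⟨ solve 4 (λ A B X Y → A :+ B :+ X :+ Y := (A :+ X) :+ (Y :+ B)) refl A B X (f 0 * (s * g′)) ⟩
  A + X + (f 0 * (s * g′) + B)
    ≡⟨ cong (_+ (f ⋆ θ g) (suc n)) (sym Df⋆g) ⟩
  (D f ⋆ g) n + (f ⋆ θ g) (suc n)
    ≡⟨ cong (_+ (f ⋆ θ g) (suc n)) (θ-⋆-suc f g n) ⟨
  (θ f ⋆ g) (suc n) + (f ⋆ θ g) (suc n) ∎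
  where
  open ≡-Reasoning
  s g′ X A B : ℚ
  s = ℕ→ℚ (suc n)
  g′ = g (suc n)
  X = (divT f ⋆ g) n
  A = (θ (divT f) ⋆ g) n
  B = (divT f ⋆ θ g) n
  Df⋆g : (D f ⋆ g) n ≡ A + X
  Df⋆g = trans (⋆-congʳ g (λ k → ℕ→ℚ-suc-* k (f (suc k))) n) (⋆-distribʳ-⊕ (θ (divT f)) (divT f) g n)

D-leibniz : ∀ f g → D (f ⋆ g) ≐ D f ⋆ g ⊕ f ⋆ D g
D-leibniz f g n = begin
  θ (f ⋆ g) (suc n)                      ≡⟨ θ-leibniz f g (suc n) ⟩
  (θ f ⋆ g) (suc n) + (f ⋆ θ g) (suc n)  ≡⟨ cong₂ _+_ (θ-⋆-suc f g n) (⋆-comm f (θ g) (suc n)) ⟩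
  (D f ⋆ g) n + (θ g ⋆ f) (suc n)        ≡⟨ cong ((D f ⋆ g) n +_) (trans (θ-⋆-suc g f n) (⋆-comm (D g) f n)) ⟩
  (D f ⋆ g) n + (f ⋆ D g) n              ∎
  where open ≡-Reasoning

D-cong : ∀ {f g} → f ≐ g → D f ≐ D g
D-cong f≐g n = cong (ℕ→ℚ (suc n) *_) (f≐g (suc n))

D-injective : ∀ {f g} → D f ≐ D g → f 0 ≡ g 0 → f ≐ g
D-injective Df≐Dg f0≡g0 zero    = f0≡g0
D-injective Df≐Dg f0≡g0 (suc n) = *-cancelˡ-≡ (ℕ→ℚ (suc n)) (ℕ→ℚ-suc≢0 n) (Df≐Dg n)

D≐scale-unique : ∀ a {f g} → D f ≐ scale a f → D g ≐ scale a g → f 0 ≡ g 0 → f ≐ g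
D≐scale-unique a Df≐af Dg≐ag f0≡g0 zero    = f0≡g0
D≐scale-unique a Df≐af Dg≐ag f0≡g0 (suc n) = *-cancelˡ-≡ (ℕ→ℚ (suc n)) (ℕ→ℚ-suc≢0 n)
  (trans (Df≐af n) (trans (cong (a *_) (D≐scale-unique a Df≐af Dg≐ag f0≡g0 n)) (sym (Dg≐ag n))))

infixr 30 _⋆^_
_⋆^_ : PS → ℕ → PS
f ⋆^ zero  = oneS
f ⋆^ suc l = f ⋆ f ⋆^ l

⊛^≐⋆^ : ∀ f l → f ⊛^ l ≐ f ⋆^ l
⊛^≐⋆^ f zero    = ≐-refl
⊛^≐⋆^ f (suc l) = ≐-trans (⊛≐⋆ f (f ⊛^ l)) (⋆-congˡ f (⊛^≐⋆^ f l))

⋆^-below : ∀ {f} → f 0 ≡ 0ℚ → ∀ l n → n < l → (f ⋆^ l) n ≡ 0ℚ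
⋆^-below {f} f0≡0 (suc l) n n<1+l = trans
  (⋆-cong-below n f {f ⋆^ l} {zeroS} f0≡0 (λ m m<n → ⋆^-below f0≡0 l m (ℕ.<-≤-trans m<n (ℕ.≤-pred n<1+l))))
  (⋆-zeroʳ-upTo n f zeroS (λ _ _ → refl))

constS-* : ∀ a b → constS (a * b) ≐ scale a (constS b)
constS-* a b zero    = refl
constS-* a b (suc n) = sym (*-zeroʳ a)

constS-0 : constS 0ℚ ≐ zeroS
constS-0 zero    = refl
constS-0 (suc _) = refl

scale-oneS : ∀ c → scale c oneS ≐ constS c
scale-oneS c zero    = *-identityʳ c
scale-oneS c (suc n) = *-zeroʳ c

module Composition (E : PS) (E0≡0 : E 0 ≡ 0ℚ) where

  comp : PS → PS
  comp F n = sumTo n (λ l → F l * (E ⋆^ l) n)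

  comp-extend : ∀ F n M → n ≤ M → sumTo M (λ l → F l * (E ⋆^ l) n) ≡ comp F n
  comp-extend F n M n≤M = sumTo-extend n M _ n≤M
    (λ l n<l → trans (cong (F l *_) (⋆^-below E0≡0 l n n<l)) (*-zeroʳ (F l)))

  comp-cong : ∀ {F F'} → F ≐ F' → comp F ≐ comp F'
  comp-cong F≐F' n = sumTo-cong n (λ l → cong (_* (E ⋆^ l) n) (F≐F' l))

  comp-⊕ : ∀ F G → comp (F ⊕ G) ≐ comp F ⊕ comp G
  comp-⊕ F G n = trans
    (sumTo-cong n (λ l → solve 3 (λ a b c → (a :+ b) :* c := a :* c :+ b :* c) refl (F l) (G l) ((E ⋆^ l) n)))
    (sumTo-distrib-+ n (λ l → F l * (E ⋆^ l) n) (λ l → G l * (E ⋆^ l) n))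

  comp-⊖ : ∀ F G → comp (F ⊖ G) ≐ comp F ⊖ comp G
  comp-⊖ F G n = trans
    (sumTo-cong n (λ l → solve 3 (λ a b c → (a :- b) :* c := a :* c :- b :* c) refl (F l) (G l) ((E ⋆^ l) n)))
    (sumTo-distrib-sub n (λ l → F l * (E ⋆^ l) n) (λ l → G l * (E ⋆^ l) n))

  comp-scale : ∀ c F → comp (scale c F) ≐ scale c (comp F)
  comp-scale c F n = trans
    (sumTo-cong n (λ l → solve 3 (λ a b c → (a :* b) :* c := a :* (b :* c)) refl c (F l) ((E ⋆^ l) n)))
    (sumTo-distribˡ-* n c (λ l → F l * (E ⋆^ l) n))

  comp-0 : ∀ F → comp F 0 ≡ F 0
  comp-0 F = *-identityʳ (F 0)

  comp-horner : ∀ F → comp F ≐ constS (F 0) ⊕ E ⋆ comp (divT F)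
  comp-horner F n = begin
    comp F n                                                      ≡⟨ comp-extend F n (suc n) (ℕ.n≤1+n n) ⟨
    sumTo (suc n) (λ l → F l * (E ⋆^ l) n)                        ≡⟨ sumTo-suc-first n (λ l → F l * (E ⋆^ l) n) ⟩
    F 0 * oneS n + sumTo n (λ l → F (suc l) * (E ⋆ E ⋆^ l) n)     ≡⟨ cong₂ _+_ (scale-oneS (F 0) n) (sym E⋆tail) ⟩
    constS (F 0) n + (E ⋆ comp (divT F)) n                        ∎
    where
    open ≡-Reasoning
    E⋆tail : (E ⋆ comp (divT F)) n ≡ sumTo n (λ l → F (suc l) * (E ⋆ E ⋆^ l) n)
    E⋆tail = begin
      (E ⋆ comp (divT F)) n
        ≡⟨ ⋆-cong-upTo n E (λ m m≤n → sym (comp-extend (divT F) m n m≤n)) ⟩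
      (E ⋆ (λ m → sumTo n (λ l → F (suc l) * (E ⋆^ l) m))) n
        ≡⟨ ⋆-distribˡ-sumTo n n E (λ l m → F (suc l) * (E ⋆^ l) m) ⟩
      sumTo n (λ l → (E ⋆ scale (F (suc l)) (E ⋆^ l)) n)
        ≡⟨ sumTo-cong n (λ l → ⋆-scaleʳ (F (suc l)) E (E ⋆^ l) n) ⟩
      sumTo n (λ l → F (suc l) * (E ⋆ E ⋆^ l) n) ∎

  comp-⋆ : ∀ F G → comp (F ⋆ G) ≐ comp F ⋆ comp G
  comp-⋆ F G n = <-rec (λ n → ∀ F G → comp (F ⋆ G) n ≡ (comp F ⋆ comp G) n) hom n F G
    where
    hom : ∀ n → (∀ {m} → m < n → ∀ F G → comp (F ⋆ G) m ≡ (comp F ⋆ comp G) m) →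
          ∀ F G → comp (F ⋆ G) n ≡ (comp F ⋆ comp G) n
    hom n ih F G = begin
      comp (F ⋆ G) n
        ≡⟨ comp-horner (F ⋆ G) n ⟩
      constS (F 0 * G 0) n + (E ⋆ comp (scale (F 0) (divT G) ⊕ divT F ⋆ G)) n
        ≡⟨ cong (constS (F 0 * G 0) n +_) (⋆-cong-below n E E0≡0 (λ m m<n →
             trans (comp-⊕ (scale (F 0) (divT G)) (divT F ⋆ G) m)
                   (cong₂ _+_ (comp-scale (F 0) (divT G) m) (ih m<n (divT F) G)))) ⟩
      constS (F 0 * G 0) n + (E ⋆ (scale (F 0) (comp (divT G)) ⊕ A ⋆ comp G)) n
        ≡⟨ cong (constS (F 0 * G 0) n +_) (trans (⋆-distribˡ-⊕ E (scale (F 0) (comp (divT G))) (A ⋆ comp G) n)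
             (cong (_+ Z) (⋆-scaleʳ (F 0) E (comp (divT G)) n))) ⟩
      constS (F 0 * G 0) n + (F 0 * Y + Z)
        ≡⟨ cong (_+ (F 0 * Y + Z)) (constS-* (F 0) (G 0) n) ⟩
      F 0 * constS (G 0) n + (F 0 * Y + Z)
        ≡⟨ solve 4 (λ a c Y Z → a :* c :+ (a :* Y :+ Z) := a :* (c :+ Y) :+ Z) refl (F 0) (constS (G 0) n) Y Z ⟩
      F 0 * (constS (G 0) n + Y) + Z
        ≡⟨ cong₂ (λ u v → F 0 * u + v) (comp-horner G n) (⋆-assoc E A (comp G) n) ⟨
      F 0 * comp G n + (E ⋆ A ⋆ comp G) n
        ≡⟨ cong (_+ (E ⋆ A ⋆ comp G) n) (constS-⋆ (F 0) (comp G) n) ⟨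
      (constS (F 0) ⋆ comp G) n + (E ⋆ A ⋆ comp G) n
        ≡⟨ ⋆-distribʳ-⊕ (constS (F 0)) (E ⋆ A) (comp G) n ⟨
      ((constS (F 0) ⊕ E ⋆ A) ⋆ comp G) n
        ≡⟨ ⋆-congʳ (comp G) (comp-horner F) n ⟨
      (comp F ⋆ comp G) n ∎
      where
      open ≡-Reasoning
      A : PS
      A = comp (divT F)
      Y Z : ℚ
      Y = (E ⋆ comp (divT G)) n
      Z = (E ⋆ (A ⋆ comp G)) n

  comp-D : ∀ F → D (comp F) ≐ comp (D F) ⋆ D E
  comp-D F n = <-rec (λ n → ∀ F → D (comp F) n ≡ (comp (D F) ⋆ D E) n) chain n F
    where
    chain : ∀ n → (∀ {m} → m < n → ∀ F → D (comp F) m ≡ (comp (D F) ⋆ D E) m) →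
            ∀ F → D (comp F) n ≡ (comp (D F) ⋆ D E) n
    chain n ih F = begin
      D (comp F) n
        ≡⟨ D-cong (comp-horner F) n ⟩
      ℕ→ℚ (suc n) * (constS (F 0) (suc n) + (E ⋆ C) (suc n))
        ≡⟨ cong (ℕ→ℚ (suc n) *_) (+-identityˡ _) ⟩
      D (E ⋆ C) n
        ≡⟨ D-leibniz E C n ⟩
      (D E ⋆ C) n + (E ⋆ D C) n
        ≡⟨ cong₂ _+_ DE⋆C (⋆-cong-below n E E0≡0 (λ m m<n → ih m<n (divT F))) ⟩
      F 1 * D E n + (E ⋆ K ⋆ D E) n + (E ⋆ (B ⋆ D E)) n
        ≡⟨ cong (F 1 * D E n + (E ⋆ K ⋆ D E) n +_) (⋆-assoc E B (D E) n) ⟨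
      F 1 * D E n + (E ⋆ K ⋆ D E) n + (E ⋆ B ⋆ D E) n
        ≡⟨ solve 3 (λ a b c → a :+ b :+ c := a :+ (c :+ b)) refl (F 1 * D E n) ((E ⋆ K ⋆ D E) n) ((E ⋆ B ⋆ D E) n) ⟩
      F 1 * D E n + ((E ⋆ B ⋆ D E) n + (E ⋆ K ⋆ D E) n)
        ≡⟨ compDF⋆DE ⟨
      (comp (D F) ⋆ D E) n ∎
      where
      open ≡-Reasoning
      C B K : PS
      C = comp (divT F)
      B = comp (D (divT F))
      K = comp (divT (divT F))

      DE⋆C : (D E ⋆ C) n ≡ F 1 * D E n + (E ⋆ K ⋆ D E) n
      DE⋆C = begin
        (D E ⋆ C) n
          ≡⟨ ⋆-congˡ (D E) (comp-horner (divT F)) n ⟩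
        (D E ⋆ (constS (F 1) ⊕ E ⋆ K)) n
          ≡⟨ ⋆-distribˡ-⊕ (D E) (constS (F 1)) (E ⋆ K) n ⟩
        (D E ⋆ constS (F 1)) n + (D E ⋆ (E ⋆ K)) n
          ≡⟨ cong₂ _+_ (trans (⋆-comm (D E) (constS (F 1)) n) (constS-⋆ (F 1) (D E) n)) (⋆-comm (D E) (E ⋆ K) n) ⟩
        F 1 * D E n + (E ⋆ K ⋆ D E) n ∎

      -- D (divT F) ⊕ divT (divT F) is divT (D F), as (k + 2) = (k + 1) + 1.
      compDF⋆DE : (comp (D F) ⋆ D E) n ≡ F 1 * D E n + ((E ⋆ B ⋆ D E) n + (E ⋆ K ⋆ D E) n)
      compDF⋆DE = begin
        (comp (D F) ⋆ D E) n
          ≡⟨ ⋆-congʳ (D E) (comp-horner (D F)) n ⟩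
        ((constS (D F 0) ⊕ E ⋆ comp (divT (D F))) ⋆ D E) n
          ≡⟨ ⋆-distribʳ-⊕ (constS (D F 0)) (E ⋆ comp (divT (D F))) (D E) n ⟩
        (constS (D F 0) ⋆ D E) n + (E ⋆ comp (divT (D F)) ⋆ D E) n
          ≡⟨ cong₂ _+_ (trans (constS-⋆ (D F 0) (D E) n) (cong (_* D E n) (*-identityˡ (F 1))))
                       (⋆-congʳ (D E) (⋆-congˡ E (≐-trans (comp-cong (λ k → ℕ→ℚ-suc-* (suc k) (F (suc (suc k)))))
                                                          (comp-⊕ (D (divT F)) (divT (divT F))))) n) ⟩
        F 1 * D E n + (E ⋆ (B ⊕ K) ⋆ D E) n
          ≡⟨ cong (F 1 * D E n +_) (⋆-congʳ (D E) (⋆-distribˡ-⊕ E B K) n) ⟩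
        F 1 * D E n + ((E ⋆ B ⊕ E ⋆ K) ⋆ D E) n
          ≡⟨ cong (F 1 * D E n +_) (⋆-distribʳ-⊕ (E ⋆ B) (E ⋆ K) (D E) n) ⟩
        F 1 * D E n + ((E ⋆ B ⋆ D E) n + (E ⋆ K ⋆ D E) n) ∎

  comp-oneS : comp oneS ≐ oneS
  comp-oneS n = begin
    comp oneS n
      ≡⟨ comp-horner oneS n ⟩
    constS 1ℚ n + (E ⋆ comp zeroS) n
      ≡⟨ cong (constS 1ℚ n +_) (⋆-zeroʳ-upTo n E (comp zeroS) (λ m _ → sumTo-0 m _ (λ l → *-zeroˡ ((E ⋆^ l) m)))) ⟩
    constS 1ℚ n + 0ℚ
      ≡⟨ +-identityʳ _ ⟩
    constS 1ℚ n
      ≡⟨ constS-1 n ⟩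
    oneS n ∎
    where
    open ≡-Reasoning
    constS-1 : constS 1ℚ ≐ oneS
    constS-1 zero    = refl
    constS-1 (suc _) = refl

  E⋆comp-divT : ∀ F → F 0 ≡ 0ℚ → E ⋆ comp (divT F) ≐ comp F
  E⋆comp-divT F F0≡0 n = begin
    (E ⋆ comp (divT F)) n
      ≡⟨ +-identityˡ _ ⟨
    0ℚ + (E ⋆ comp (divT F)) n
      ≡⟨ cong (_+ (E ⋆ comp (divT F)) n) (trans (cong (λ c → constS c n) F0≡0) (constS-0 n)) ⟨
    constS (F 0) n + (E ⋆ comp (divT F)) n
      ≡⟨ comp-horner F n ⟨
    comp F n ∎
    where open ≡-Reasoning

  comp-tS : comp tS ≐ E
  comp-tS = ≐-trans (≐-sym (E⋆comp-divT tS refl)) (≐-trans (⋆-congˡ E comp-oneS) (⋆-identityʳ E))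

  -- The chain rule, with E′ = 1 + E = (1 + t) ∘ E.
  comp-ode : D E ≐ oneS ⊕ E → ∀ F Q → (oneS ⊕ tS) ⋆ D F ≐ Q → D (comp F) ≐ comp Q
  comp-ode DE≐1+E F Q [1+t]DF≐Q = begin
    D (comp F)                     ≈⟨ comp-D F ⟩
    comp (D F) ⋆ D E               ≈⟨ ⋆-congˡ (comp (D F)) DE≐1+E ⟩
    comp (D F) ⋆ (oneS ⊕ E)        ≈⟨ ⋆-congˡ (comp (D F)) (λ n → cong₂ _+_ (comp-oneS n) (comp-tS n)) ⟨
    comp (D F) ⋆ (comp oneS ⊕ comp tS) ≈⟨ ⋆-congˡ (comp (D F)) (comp-⊕ oneS tS) ⟨
    comp (D F) ⋆ comp (oneS ⊕ tS)  ≈⟨ comp-⋆ (D F) (oneS ⊕ tS) ⟨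
    comp (D F ⋆ (oneS ⊕ tS))       ≈⟨ comp-cong (≐-trans (⋆-comm (D F) (oneS ⊕ tS)) [1+t]DF≐Q) ⟩
    comp Q                         ∎
    where open SetoidReasoning ≐-setoid

D-expS : ∀ a → D (expS a) ≐ scale a (expS a)
D-expS a n = begin
  s * (a * a ^ n * invFact (suc n))
    ≡⟨ solve 4 (λ s a p i → s :* ((a :* p) :* i) := a :* (p :* (s :* i))) refl s a (a ^ n) (invFact (suc n)) ⟩
  a * (a ^ n * (s * invFact (suc n)))
    ≡⟨ cong (λ z → a * (a ^ n * z)) (ℕ→ℚ-suc*invFact-suc n) ⟩
  a * (a ^ n * invFact n) ∎
  where
  open ≡-Reasoning
  s : ℚ
  s = ℕ→ℚ (suc n)

D-onePlusTPow : ∀ a n → D (onePlusTPow a) n ≡ (a - ℕ→ℚ n) * onePlusTPow a n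
D-onePlusTPow a n = begin
  s * (falling a n * (a - ℕ→ℚ n) * invFact (suc n))
    ≡⟨ solve 4 (λ s f c i → s :* ((f :* c) :* i) := c :* (f :* (s :* i))) refl s (falling a n) (a - ℕ→ℚ n) (invFact (suc n)) ⟩
  (a - ℕ→ℚ n) * (falling a n * (s * invFact (suc n)))
    ≡⟨ cong (λ z → (a - ℕ→ℚ n) * (falling a n * z)) (ℕ→ℚ-suc*invFact-suc n) ⟩
  (a - ℕ→ℚ n) * onePlusTPow a n ∎
  where
  open ≡-Reasoning
  s : ℚ
  s = ℕ→ℚ (suc n)

D-log1pS : ∀ n → D log1pS n ≡ (- 1ℚ) ^ n
D-log1pS n = begin
  s * ((- 1ℚ) ^ n * recip s)     ≡⟨ solve 3 (λ s x r → s :* (x :* r) := x :* (s :* r)) refl s ((- 1ℚ) ^ n) (recip s) ⟩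
  (- 1ℚ) ^ n * (s * recip s)     ≡⟨ cong ((- 1ℚ) ^ n *_) (*-recip s (ℕ→ℚ-suc≢0 n)) ⟩
  (- 1ℚ) ^ n * 1ℚ                ≡⟨ *-identityʳ _ ⟩
  (- 1ℚ) ^ n                     ∎
  where
  open ≡-Reasoning
  s : ℚ
  s = ℕ→ℚ (suc n)

[1+t]⋆-0 : ∀ f → ((oneS ⊕ tS) ⋆ f) 0 ≡ f 0
[1+t]⋆-0 f = trans (⋆-distribʳ-⊕ oneS tS f 0) (trans (cong₂ _+_ (⋆-identityˡ f 0) (*-zeroˡ (f 0))) (+-identityʳ (f 0)))

[1+t]⋆-suc : ∀ f n → ((oneS ⊕ tS) ⋆ f) (suc n) ≡ f (suc n) + f n
[1+t]⋆-suc f n = trans (⋆-distribʳ-⊕ oneS tS f (suc n)) (cong₂ _+_ (⋆-identityˡ f (suc n)) (tS-⋆-suc f n))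

onePlusTPow-ode : ∀ a → (oneS ⊕ tS) ⋆ D (onePlusTPow a) ≐ scale a (onePlusTPow a)
onePlusTPow-ode a zero    = trans ([1+t]⋆-0 (D (onePlusTPow a)))
                                  (trans (D-onePlusTPow a 0) (cong (_* onePlusTPow a 0) (+-identityʳ a)))
onePlusTPow-ode a (suc n) = begin
  ((oneS ⊕ tS) ⋆ D P) (suc n)
    ≡⟨ [1+t]⋆-suc (D P) n ⟩
  D P (suc n) + ℕ→ℚ (suc n) * P (suc n)
    ≡⟨ cong (_+ ℕ→ℚ (suc n) * P (suc n)) (D-onePlusTPow a (suc n)) ⟩
  (a - ℕ→ℚ (suc n)) * P (suc n) + ℕ→ℚ (suc n) * P (suc n)
                                                     ≡⟨ solve 3 (λ a s p → (a :- s) :* p :+ s :* p := a :* p) refl a (ℕ→ℚ (suc n)) (P (suc n)) ⟩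
  a * P (suc n) ∎
  where
  open ≡-Reasoning
  P : PS
  P = onePlusTPow a

log1pS-ode : (oneS ⊕ tS) ⋆ D log1pS ≐ oneS
log1pS-ode zero    = trans ([1+t]⋆-0 (D log1pS)) (D-log1pS 0)
log1pS-ode (suc n) = begin
  ((oneS ⊕ tS) ⋆ D log1pS) (suc n)   ≡⟨ [1+t]⋆-suc (D log1pS) n ⟩
  D log1pS (suc n) + D log1pS n      ≡⟨ cong₂ _+_ (D-log1pS (suc n)) (D-log1pS n) ⟩
  - 1ℚ * (- 1ℚ) ^ n + (- 1ℚ) ^ n     ≡⟨ solve 1 (λ x → :- con 1ℚ :* x :+ x := con 0ℚ) refl ((- 1ℚ) ^ n) ⟩
  0ℚ                                 ∎
  where open ≡-Reasoning

D-tS : D tS ≐ oneS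
D-tS zero    = *-identityˡ 1ℚ
D-tS (suc n) = *-zeroʳ (ℕ→ℚ (suc (suc n)))

expm1S : PS
expm1S = expS 1ℚ ⊖ oneS

D-expm1S : D expm1S ≐ oneS ⊕ expm1S
D-expm1S n = begin
  ℕ→ℚ (suc n) * (expS 1ℚ (suc n) - 0ℚ)   ≡⟨ cong (ℕ→ℚ (suc n) *_) (+-identityʳ (expS 1ℚ (suc n))) ⟩
  D (expS 1ℚ) n                          ≡⟨ D-expS 1ℚ n ⟩
  1ℚ * expS 1ℚ n                         ≡⟨ solve 2 (λ e o → con 1ℚ :* e := o :+ (e :- o)) refl (expS 1ℚ n) (oneS n) ⟩
  oneS n + expm1S n                      ∎
  where open ≡-Reasoning

open Composition expm1S refl

comp-onePlusTPow : ∀ a → comp (onePlusTPow a) ≐ expS a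
comp-onePlusTPow a = D≐scale-unique a
  (≐-trans (comp-ode D-expm1S (onePlusTPow a) _ (onePlusTPow-ode a)) (comp-scale a (onePlusTPow a)))
  (D-expS a) (comp-0 (onePlusTPow a))

comp-log1pS : comp log1pS ≐ tS
comp-log1pS = D-injective (≐-trans (comp-ode D-expm1S log1pS oneS log1pS-ode) (≐-trans comp-oneS (≐-sym D-tS)))
                          (comp-0 log1pS)

⋆-inverse-unique : ∀ f {g h} → ¬ f 0 ≡ 0ℚ → f ⋆ g ≐ h → g ≐ invS f ⋆ h
⋆-inverse-unique f {g} {h} f0≢0 f⋆g≐h = begin
  g                    ≈⟨ ⋆-identityˡ g ⟨
  oneS ⋆ g             ≈⟨ ⋆-congʳ g (⋆-inverseˡ f f0≢0) ⟨
  invS f ⋆ f ⋆ g       ≈⟨ ⋆-assoc (invS f) f g ⟩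
  invS f ⋆ (f ⋆ g)     ≈⟨ ⋆-congˡ (invS f) f⋆g≐h ⟩
  invS f ⋆ h           ∎
  where open SetoidReasoning ≐-setoid

-- V = ((1 + t) − (1 + t)⁻¹) / t and W = (e^t − e^{−t}) / t, both with constant term 2.
V W L : PS
V = divT (onePlusTPow 1ℚ ⊖ onePlusTPow (- 1ℚ))
W = divT (expS 1ℚ ⊖ expS (- 1ℚ))
L = divT log1pS

V0≢0 : ¬ V 0 ≡ 0ℚ
V0≢0 ()

W0≢0 : ¬ W 0 ≡ 0ℚ
W0≢0 ()

expm1S⋆comp-V : expm1S ⋆ comp V ≐ tS ⋆ W
expm1S⋆comp-V = begin
  expm1S ⋆ comp V                                    ≈⟨ E⋆comp-divT (onePlusTPow 1ℚ ⊖ onePlusTPow (- 1ℚ)) refl ⟩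
  comp (onePlusTPow 1ℚ ⊖ onePlusTPow (- 1ℚ))         ≈⟨ comp-⊖ (onePlusTPow 1ℚ) (onePlusTPow (- 1ℚ)) ⟩
  comp (onePlusTPow 1ℚ) ⊖ comp (onePlusTPow (- 1ℚ))  ≈⟨ ⊖-cong (comp-onePlusTPow 1ℚ) (comp-onePlusTPow (- 1ℚ)) ⟩
  expS 1ℚ ⊖ expS (- 1ℚ)                              ≈⟨ tS-⋆-divT (expS 1ℚ ⊖ expS (- 1ℚ)) refl ⟨
  tS ⋆ W                                             ∎
  where open SetoidReasoning ≐-setoid

expm1S⋆comp-L : expm1S ⋆ comp L ≐ tS
expm1S⋆comp-L = ≐-trans (E⋆comp-divT log1pS refl) comp-log1pS

daeheeGF⋆V : ∀ x → daeheeGF x ⋆ V ≐ L ⋆ onePlusTPow x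
daeheeGF⋆V x = begin
  daeheeGF x ⋆ V                ≈⟨ ⋆-congʳ V (≐-trans (⊛≐⋆ (L ⊛ invS V) P) (⋆-congʳ P (⊛≐⋆ L (invS V)))) ⟩
  L ⋆ invS V ⋆ P ⋆ V            ≈⟨ ⋆-assoc (L ⋆ invS V) P V ⟩
  L ⋆ invS V ⋆ (P ⋆ V)          ≈⟨ ⋆-congˡ (L ⋆ invS V) (⋆-comm P V) ⟩
  L ⋆ invS V ⋆ (V ⋆ P)          ≈⟨ ⋆-assoc L (invS V) (V ⋆ P) ⟩
  L ⋆ (invS V ⋆ (V ⋆ P))        ≈⟨ ⋆-congˡ L (⋆-assoc (invS V) V P) ⟨
  L ⋆ (invS V ⋆ V ⋆ P)          ≈⟨ ⋆-congˡ L (⋆-congʳ P (⋆-inverseˡ V V0≢0)) ⟩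
  L ⋆ (oneS ⋆ P)                ≈⟨ ⋆-congˡ L (⋆-identityˡ P) ⟩
  L ⋆ P                         ∎
  where
  open SetoidReasoning ≐-setoid
  P : PS
  P = onePlusTPow x

comp-daeheeGF : ∀ x → comp (daeheeGF x) ≐ bernoulliGF x
comp-daeheeGF x = ≐-trans (⋆-inverse-unique W W0≢0 (tS-⋆-cancel t⋆W⋆cD≐t⋆eˣ)) (≐-sym (⊛≐⋆ (invS W) (expS x)))
  where
  open SetoidReasoning ≐-setoid
  cD : PS
  cD = comp (daeheeGF x)
  t⋆W⋆cD≐t⋆eˣ : tS ⋆ (W ⋆ cD) ≐ tS ⋆ expS x
  t⋆W⋆cD≐t⋆eˣ = begin
    tS ⋆ (W ⋆ cD)                        ≈⟨ ⋆-assoc tS W cD ⟨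
    tS ⋆ W ⋆ cD                          ≈⟨ ⋆-congʳ cD expm1S⋆comp-V ⟨
    expm1S ⋆ comp V ⋆ cD                 ≈⟨ ⋆-assoc expm1S (comp V) cD ⟩
    expm1S ⋆ (comp V ⋆ cD)               ≈⟨ ⋆-congˡ expm1S (⋆-comm (comp V) cD) ⟩
    expm1S ⋆ (cD ⋆ comp V)               ≈⟨ ⋆-congˡ expm1S (comp-⋆ (daeheeGF x) V) ⟨
    expm1S ⋆ comp (daeheeGF x ⋆ V)       ≈⟨ ⋆-congˡ expm1S (comp-cong (daeheeGF⋆V x)) ⟩
    expm1S ⋆ comp (L ⋆ onePlusTPow x)    ≈⟨ ⋆-congˡ expm1S (comp-⋆ L (onePlusTPow x)) ⟩
    expm1S ⋆ (comp L ⋆ comp (onePlusTPow x)) ≈⟨ ⋆-congˡ expm1S (⋆-congˡ (comp L) (comp-onePlusTPow x)) ⟩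
    expm1S ⋆ (comp L ⋆ expS x)           ≈⟨ ⋆-assoc expm1S (comp L) (expS x) ⟨
    expm1S ⋆ comp L ⋆ expS x             ≈⟨ ⋆-congʳ (expS x) expm1S⋆comp-L ⟩
    tS ⋆ expS x                          ∎

S₂*d : ∀ n l x → S₂ n l * d l x ≡ fact n * (daeheeGF x l * (expm1S ⋆^ l) n)
S₂*d n l x = begin
  fact n * (invFact l * (expm1S ⊛^ l) n) * (fact l * daeheeGF x l)
    ≡⟨ solve 5 (λ F i p f δ → (F :* (i :* p)) :* (f :* δ) := F :* ((f :* i) :* (δ :* p))) refl
             (fact n) (invFact l) ((expm1S ⊛^ l) n) (fact l) (daeheeGF x l) ⟩
  fact n * (fact l * invFact l * (daeheeGF x l * (expm1S ⊛^ l) n))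
    ≡⟨ cong (λ z → fact n * (z * (daeheeGF x l * (expm1S ⊛^ l) n))) (fact*invFact l) ⟩
  fact n * (1ℚ * (daeheeGF x l * (expm1S ⊛^ l) n))
    ≡⟨ cong (fact n *_) (trans (*-identityˡ _) (cong (daeheeGF x l *_) (⊛^≐⋆^ expm1S l n))) ⟩
  fact n * (daeheeGF x l * (expm1S ⋆^ l) n) ∎
  where open ≡-Reasoning

b≡sumTo-S₂*d : ∀ n x → b n x ≡ sumTo n (λ l → S₂ n l * d l x)
b≡sumTo-S₂*d n x = begin
  fact n * bernoulliGF x n
    ≡⟨ cong (fact n *_) (comp-daeheeGF x n) ⟨
  fact n * comp (daeheeGF x) n
    ≡⟨ sumTo-distribˡ-* n (fact n) (λ l → daeheeGF x l * (expm1S ⋆^ l) n) ⟨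
  sumTo n (λ l → fact n * (daeheeGF x l * (expm1S ⋆^ l) n))
    ≡⟨ sumTo-cong n (λ l → S₂*d n l x) ⟨
  sumTo n (λ l → S₂ n l * d l x) ∎
  where open ≡-Reasoning

theorem4 : ((n : ℕ) → (x : ℚ) → b n x ≡ sumTo n (λ l → S₂ n l * d l x))
           × ((n : ℕ) → b n 0ℚ ≡ sumTo n (λ l → S₂ n l * d l 0ℚ))
theorem4 = b≡sumTo-S₂*d , λ n → b≡sumTo-S₂*d n 0ℚ
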